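{- For every $H\in\mathcal{H}$ and every positive integer $t$, there exists an edge-colored complete graph colored in $t$ or more colors that is rainbow $H$-free.
   Context: All graphs are finite and simple. An edge-colored graph is a pair $(G,c)$ with $c\colon E(G)\to\mathbb{N}$ an arbitrary map (not necessarily proper); it is colored in $t$ or more colors if $|c(E(G))|\ge t$. A subgraph (not necessarily induced) is rainbow if its edges receive pairwise distinct colors. $(G,c)$ is rainbow $H$-free if $G$ contains no rainbow subgraph isomorphic to $H$. $\mathcal{H}$ denotes the set of connected finite simple graphs other than the paths $P_1,P_2,P_3,P_4$ ($P_k$ is the path on $k$ vertices). -}

module Defs where

open import Data.Nat using (ℕ; zero; suc; _≤_; _≡ᵇ_)
open import Data.Fin using (Fin; toℕ)
open import Data.Bool using (Bool; true; false; _∨_)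
open import Data.Product using (Σ; ∃; _×_; _,_)
open import Data.Sum using (_⊎_)
open import Relation.Binary.PropositionalEquality using (_≡_; _≢_)
open import Relation.Nullary using (¬_)
open import Function.Definitions using (Injective; Bijective)

Adjacency : ℕ → Set
Adjacency n = Fin n → Fin n → Bool

IsSimple : {n : ℕ} → Adjacency n → Set
IsSimple {n} A = (∀ (u v : Fin n) → A u v ≡ A v u) × (∀ (u : Fin n) → A u u ≡ false)

data Walk {n : ℕ} (A : Adjacency n) : Fin n → Fin n → Set where
  here : ∀ {u} → Walk A u u
  step : ∀ {u w v} → A u w ≡ true → Walk A w v → Walk A u v

Connected : {n : ℕ} → Adjacency n → Set
Connected {n} A = (1 ≤ n) × (∀ (u v : Fin n) → Walk A u v)

Iso : {n k : ℕ} → Adjacency n → Adjacency k → Set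
Iso {n} {k} A B =
  Σ (Fin n → Fin k) λ f → Bijective _≡_ _≡_ f × (∀ (u v : Fin n) → A u v ≡ B (f u) (f v))

PathAdj : (k : ℕ) → Adjacency k
PathAdj k i j = (suc (toℕ i) ≡ᵇ toℕ j) ∨ (suc (toℕ j) ≡ᵇ toℕ i)

InCalH : {n : ℕ} → Adjacency n → Set
InCalH {n} A = IsSimple A × Connected A × (∀ (p : ℕ) → 1 ≤ p → p ≤ 4 → ¬ Iso A (PathAdj p))

-- An edge coloring of the complete graph K_m: a color for each unordered
-- pair, encoded as a symmetric function (diagonal values are irrelevant).
EdgeColoring : ℕ → Set
EdgeColoring m = Σ (Fin m → Fin m → ℕ) λ c → ∀ (i j : Fin m) → c i j ≡ c j i

ColoredInAtLeast : {m : ℕ} → ℕ → EdgeColoring m → Set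
ColoredInAtLeast {m} t (c , _) =
  Σ (Fin t → Fin m) λ e₁ → Σ (Fin t → Fin m) λ e₂ →
    (∀ (a : Fin t) → e₁ a ≢ e₂ a) ×
    (∀ (a b : Fin t) → c (e₁ a) (e₂ a) ≡ c (e₁ b) (e₂ b) → a ≡ b)

-- A rainbow copy of H in (K_m, c): an injective vertex map (every such map
-- gives a subgraph of K_m isomorphic to H) such that distinct edges of H
-- are sent to edges of distinct colors.
RainbowCopy : {n m : ℕ} → Adjacency n → EdgeColoring m → Set
RainbowCopy {n} {m} A (c , _) =
  Σ (Fin n → Fin m) λ φ → Injective _≡_ _≡_ φ ×
    (∀ (u v u' v' : Fin n) → A u v ≡ true → A u' v' ≡ true →
       c (φ u) (φ v) ≡ c (φ u') (φ v') →
       (u ≡ u' × v ≡ v') ⊎ (u ≡ v' × v ≡ u'))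

RainbowFree : {n m : ℕ} → Adjacency n → EdgeColoring m → Set
RainbowFree A c = ¬ RainbowCopy A c

-- Colour K_{2t} by pairing up its vertices into t blocks of size two: the edge
-- inside the i-th block gets colour i + 1 and every other edge gets colour 0.
-- A rainbow copy of H then consists of a matching (edges inside blocks) plus at
-- most one further edge (of colour 0). A connected graph of this shape is a
-- single vertex, a matching edge, or a crossing edge extended at each end by at
-- most one matching edge, i.e. one of P₁, P₂, P₃, P₄.
module Submission where

open import Defs
open import Data.Bool using (true; false)
open import Data.Bool.Properties using (⇔→≡; T-≡) renaming (_≟_ to _≟ᵇ_)
open import Data.Empty using (⊥-elim)
open import Data.Fin using (Fin; zero; suc; toℕ; fromℕ<; quotient; remainder; combine)
open import Data.Fin.Properties
  using (any?; toℕ-injective; remQuot-combine; combine-remQuot; combine-injectiveʳ)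
  renaming (_≟_ to _≟ᶠ_)
open import Data.Nat using (ℕ; zero; suc; _≤_; _≤?_; _*_; _≡ᵇ_)
open import Data.Nat.Properties using (≡ᵇ⇒≡; suc-injective)
open import Data.Product using (Σ; ∃; ∃₂; _×_; _,_; proj₁; proj₂)
open import Data.Sum using (_⊎_; inj₁; inj₂; swap)
open import Data.Vec using (Vec; []; _∷_; lookup)
open import Data.Vec.Relation.Unary.All using ([]; _∷_)
open import Data.Vec.Relation.Unary.Linked using (Linked; [-]; _∷_)
open import Data.Vec.Relation.Unary.Unique.Propositional using (Unique; []; _∷_)
open import Data.Vec.Relation.Unary.Unique.Propositional.Properties using (lookup-injective)
open import Function using (_∘_; Equivalence; mk⇔)
open import Relation.Binary.Definitions using (DecidableEquality)
open import Relation.Binary.PropositionalEquality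
open import Relation.Nullary using (¬_; Dec; yes; no; contradiction)
open import Relation.Nullary.Decidable using (True; toWitness; _×-dec_; ¬?; decidable-stable)

Edge : ∀ {n} → Adjacency n → Fin n → Fin n → Set
Edge H u v = H u v ≡ true

ShortPath : ∀ {n} → Adjacency n → Set
ShortPath H = Σ ℕ λ p → 1 ≤ p × p ≤ 4 × Iso H (PathAdj p)

shortPath : ∀ {n} {H : Adjacency n} p → {True (1 ≤? p)} → {True (p ≤? 4)} →
  Iso H (PathAdj p) → ShortPath H
shortPath p {1≤p} {p≤4} iso = p , toWitness 1≤p , toWitness p≤4 , iso

walk-preserves : ∀ {n} {H : Adjacency n} (P : Fin n → Set) →
  (∀ {u v} → P u → Edge H u v → P v) → ∀ {u v} → P u → Walk H u v → P v
walk-preserves P closed pu here       = pu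
walk-preserves P closed pu (step e w) = walk-preserves P closed (closed pu e) w

linked-lookup : ∀ {a} {A : Set a} {R : A → A → Set} {p} {xs : Vec A p} → Linked R xs →
  ∀ i j → suc (toℕ i) ≡ toℕ j → R (lookup xs i) (lookup xs j)
linked-lookup {xs = _ ∷ _ ∷ _} (r ∷ _) zero (suc zero) _ = r
linked-lookup (_ ∷ rs) (suc i) (suc j)       e  = linked-lookup rs i j (suc-injective e)
linked-lookup _        zero    zero          ()
linked-lookup _        zero    (suc (suc _)) ()
linked-lookup _        (suc _) zero          ()

pathAdj⇒consecutive : ∀ {p} (i j : Fin p) → Edge (PathAdj p) i j →
  suc (toℕ i) ≡ toℕ j ⊎ suc (toℕ j) ≡ toℕ i
pathAdj⇒consecutive i j e with suc (toℕ i) ≡ᵇ toℕ j in ij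
... | true  = inj₁ (≡ᵇ⇒≡ _ _ (Equivalence.from T-≡ ij))
... | false = inj₂ (≡ᵇ⇒≡ _ _ (Equivalence.from T-≡ e))

module _ {n} {H : Adjacency n} (simple : IsSimple H) where

  edge-sym : ∀ {u v} → Edge H u v → Edge H v u
  edge-sym {u} {v} e = trans (proj₁ simple v u) e

  edge⇒≢ : ∀ {u v} → Edge H u v → u ≢ v
  edge⇒≢ {u} e refl with () ← trans (sym e) (proj₂ simple u)

  module _ (connected : Connected H) where

    path-iso : ∀ {p} (xs : Vec (Fin n) (suc p)) → Unique xs → Linked (Edge H) xs →
      (∀ i {v} → Edge H (lookup xs i) v → ∃ λ j → Edge (PathAdj (suc p)) i j × lookup xs j ≡ v) →
      Iso H (PathAdj (suc p))
    path-iso {p} xs unique linked closed = f , (f-injective , f-surjective) , adjacency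
      where
      g : Fin (suc p) → Fin n
      g = lookup xs

      covered : ∀ u → ∃ λ i → g i ≡ u
      covered u = walk-preserves (λ u → ∃ λ i → g i ≡ u) extend (zero , refl)
                    (proj₂ connected (g zero) u)
        where
        extend : ∀ {u v} → (∃ λ i → g i ≡ u) → Edge H u v → ∃ λ j → g j ≡ v
        extend (i , refl) e with j , _ , gj≡v ← closed i e = j , gj≡v

      f : Fin n → Fin (suc p)
      f u = proj₁ (covered u)

      g∘f : ∀ u → g (f u) ≡ u
      g∘f u = proj₂ (covered u)

      f-injective : ∀ {u v} → f u ≡ f v → u ≡ v
      f-injective {u} {v} eq = trans (sym (g∘f u)) (trans (cong g eq) (g∘f v))

      f-surjective : ∀ i → ∃ λ u → ∀ {w} → w ≡ u → f w ≡ i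
      f-surjective i = g i , λ { refl → lookup-injective unique _ _ (g∘f (g i)) }

      pathAdj⇒edge : ∀ i j → Edge (PathAdj (suc p)) i j → Edge H (g i) (g j)
      pathAdj⇒edge i j e with pathAdj⇒consecutive i j e
      ... | inj₁ i→j = linked-lookup linked i j i→j
      ... | inj₂ j→i = edge-sym (linked-lookup linked j i j→i)

      edge⇒pathAdj : ∀ i j → Edge H (g i) (g j) → Edge (PathAdj (suc p)) i j
      edge⇒pathAdj i j e with k , ik , gk≡gj ← closed i e
        rewrite lookup-injective unique k j gk≡gj = ik

      adjacency : ∀ u v → H u v ≡ PathAdj (suc p) (f u) (f v)
      adjacency u v = begin
        H u v                       ≡⟨ cong₂ H (sym (g∘f u)) (sym (g∘f v)) ⟩
        H (g (f u)) (g (f v))       ≡⟨ ⇔→≡ (mk⇔ (edge⇒pathAdj _ _) (pathAdj⇒edge _ _)) ⟩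
        PathAdj (suc p) (f u) (f v) ∎
        where open ≡-Reasoning

    path₁ : ∀ {x} → (∀ {v} → ¬ Edge H x v) → Iso H (PathAdj 1)
    path₁ {x} isolated = path-iso (x ∷ []) ([] ∷ []) [-] λ { zero e → ⊥-elim (isolated e) }

    path₂ : ∀ {x y} → Edge H x y →
      (∀ {v} → Edge H x v → v ≡ y) → (∀ {v} → Edge H y v → v ≡ x) → Iso H (PathAdj 2)
    path₂ {x} {y} xy x-nbrs y-nbrs =
      path-iso (x ∷ y ∷ []) ((edge⇒≢ xy ∷ []) ∷ [] ∷ []) (xy ∷ [-]) closed
      where
      closed : ∀ i {v} → Edge H (lookup (x ∷ y ∷ []) i) v →
        ∃ λ j → Edge (PathAdj 2) i j × lookup (x ∷ y ∷ []) j ≡ v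
      closed zero       e = suc zero , refl , sym (x-nbrs e)
      closed (suc zero) e = zero , refl , sym (y-nbrs e)

    path₃ : ∀ {x y z} → Edge H x y → Edge H y z → x ≢ z →
      (∀ {v} → Edge H x v → v ≡ y) → (∀ {v} → Edge H y v → v ≡ x ⊎ v ≡ z) →
      (∀ {v} → Edge H z v → v ≡ y) → Iso H (PathAdj 3)
    path₃ {x} {y} {z} xy yz x≢z x-nbrs y-nbrs z-nbrs =
      path-iso (x ∷ y ∷ z ∷ [])
        ((edge⇒≢ xy ∷ x≢z ∷ []) ∷ (edge⇒≢ yz ∷ []) ∷ [] ∷ []) (xy ∷ yz ∷ [-]) closed
      where
      closed : ∀ i {v} → Edge H (lookup (x ∷ y ∷ z ∷ []) i) v →
        ∃ λ j → Edge (PathAdj 3) i j × lookup (x ∷ y ∷ z ∷ []) j ≡ v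
      closed zero             e = suc zero , refl , sym (x-nbrs e)
      closed (suc zero)       e with y-nbrs e
      ... | inj₁ refl = zero , refl , refl
      ... | inj₂ refl = suc (suc zero) , refl , refl
      closed (suc (suc zero)) e = suc zero , refl , sym (z-nbrs e)

    path₄ : ∀ {w x y z} → Edge H w x → Edge H x y → Edge H y z → w ≢ y → w ≢ z → x ≢ z →
      (∀ {v} → Edge H w v → v ≡ x) → (∀ {v} → Edge H x v → v ≡ w ⊎ v ≡ y) →
      (∀ {v} → Edge H y v → v ≡ x ⊎ v ≡ z) → (∀ {v} → Edge H z v → v ≡ y) →
      Iso H (PathAdj 4)
    path₄ {w} {x} {y} {z} wx xy yz w≢y w≢z x≢z w-nbrs x-nbrs y-nbrs z-nbrs =
      path-iso (w ∷ x ∷ y ∷ z ∷ [])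
        ((edge⇒≢ wx ∷ w≢y ∷ w≢z ∷ []) ∷ (edge⇒≢ xy ∷ x≢z ∷ []) ∷ (edge⇒≢ yz ∷ []) ∷ [] ∷ [])
        (wx ∷ xy ∷ yz ∷ [-]) closed
      where
      closed : ∀ i {v} → Edge H (lookup (w ∷ x ∷ y ∷ z ∷ []) i) v →
        ∃ λ j → Edge (PathAdj 4) i j × lookup (w ∷ x ∷ y ∷ z ∷ []) j ≡ v
      closed zero                   e = suc zero , refl , sym (w-nbrs e)
      closed (suc zero)             e with x-nbrs e
      ... | inj₁ refl = zero , refl , refl
      ... | inj₂ refl = suc (suc zero) , refl , refl
      closed (suc (suc zero))       e with y-nbrs e
      ... | inj₁ refl = suc zero , refl , refl
      ... | inj₂ refl = suc (suc (suc zero)) , refl , refl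
      closed (suc (suc (suc zero))) e = suc (suc zero) , refl , sym (z-nbrs e)

module MatchingPlusEdge {n} {H : Adjacency n} (simple : IsSimple H) (connected : Connected H)
  {A : Set} (_≟_ : DecidableEquality A) (κ : Fin n → A)
  (inner-unique : ∀ {u v w} → Edge H u v → Edge H u w → κ u ≡ κ v → κ u ≡ κ w → v ≡ w)
  (crossing-unique : ∀ {u v u′ v′} → Edge H u v → Edge H u′ v′ → κ u ≢ κ v → κ u′ ≢ κ v′ →
     (u ≡ u′ × v ≡ v′) ⊎ (u ≡ v′ × v ≡ u′))
  where

  Partner : Fin n → Fin n → Set
  Partner u v = Edge H u v × κ u ≡ κ v

  Crossing : Fin n → Fin n → Set
  Crossing u v = Edge H u v × κ u ≢ κ v

  partner? : ∀ u → Dec (∃ (Partner u))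
  partner? u = any? λ v → (H u v ≟ᵇ true) ×-dec (κ u ≟ κ v)

  crossing? : Dec (∃₂ Crossing)
  crossing? = any? λ u → any? λ v → (H u v ≟ᵇ true) ×-dec ¬? (κ u ≟ κ v)

  crossing-sym : ∀ {a b} → Crossing a b → Crossing b a
  crossing-sym (ab , κa≢κb) = edge-sym simple ab , κa≢κb ∘ sym

  partner-unique : ∀ {u v w} → Partner u v → Partner u w → v ≡ w
  partner-unique (uv , κuv) (uw , κuw) = inner-unique uv uw κuv κuw

  neighbour-of-crossing-end : ∀ {a b v} → Crossing a b → Edge H a v → v ≡ b ⊎ Partner a v
  neighbour-of-crossing-end {a} {b} {v} (ab , κa≢κb) av with κ a ≟ κ v
  ... | yes κav = inj₂ (av , κav)
  ... | no κa≢κv with crossing-unique av ab κa≢κv κa≢κb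
  ...   | inj₁ (_ , v≡b) = inj₁ v≡b
  ...   | inj₂ (a≡b , _) = contradiction a≡b (edge⇒≢ simple ab)

  neighbour-of-matched-end : ∀ {a b a′ v} → Crossing a b → Partner a a′ → Edge H a v →
    v ≡ a′ ⊎ v ≡ b
  neighbour-of-matched-end ab aa′ av with neighbour-of-crossing-end ab av
  ... | inj₁ v≡b = inj₂ v≡b
  ... | inj₂ av′ = inj₁ (partner-unique av′ aa′)

  neighbour-of-unmatched-end : ∀ {a b v} → Crossing a b → ¬ ∃ (Partner a) → Edge H a v → v ≡ b
  neighbour-of-unmatched-end ab unmatched av with neighbour-of-crossing-end ab av
  ... | inj₁ v≡b = v≡b
  ... | inj₂ av′ = contradiction (_ , av′) unmatched

  partner≢crossing-end : ∀ {a b a′} → Crossing a b → Partner a a′ → a′ ≢ b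
  partner≢crossing-end (_ , κa≢κb) (_ , κaa′) a′≡b = κa≢κb (trans κaa′ (cong κ a′≡b))

  partners-distinct : ∀ {a b a′ b′} → Crossing a b → Partner a a′ → Partner b b′ → a′ ≢ b′
  partners-distinct (_ , κa≢κb) (_ , κaa′) (_ , κbb′) a′≡b′ =
    κa≢κb (trans κaa′ (trans (cong κ a′≡b′) (sym κbb′)))

  -- a′ ∉ {a, b}, so no crossing edge meets a′, and a is its only partner.
  neighbour-of-partner : ∀ {a b a′ v} → Crossing a b → Partner a a′ → Edge H a′ v → v ≡ a
  neighbour-of-partner {a} {b} {a′} {v} (ab , κa≢κb) (aa′ , κaa′) a′v with κ a′ ≟ κ v
  ... | yes κa′v = sym (partner-unique (edge-sym simple aa′ , sym κaa′) (a′v , κa′v))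
  ... | no κa′≢κv with crossing-unique a′v ab κa′≢κv κa≢κb
  ...   | inj₁ (a′≡a , _) = contradiction (sym a′≡a) (edge⇒≢ simple aa′)
  ...   | inj₂ (a′≡b , _) = contradiction (trans κaa′ (cong κ a′≡b)) κa≢κb

  matched-at-one-end : ∀ {a b a′} → Crossing a b → Partner a a′ → ¬ ∃ (Partner b) →
    Iso H (PathAdj 3)
  matched-at-one-end ab aa′ b-unmatched =
    path₃ simple connected (edge-sym simple (proj₁ aa′)) (proj₁ ab) (partner≢crossing-end ab aa′)
      (neighbour-of-partner ab aa′) (neighbour-of-matched-end ab aa′)
      (neighbour-of-unmatched-end (crossing-sym ab) b-unmatched)

  crossing⇒short-path : ∀ {a b} → Crossing a b → ShortPath H
  crossing⇒short-path {a} {b} ab with partner? a | partner? b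
  ... | yes (_ , aa′) | yes (_ , bb′) = shortPath 4
    (path₄ simple connected (edge-sym simple (proj₁ aa′)) (proj₁ ab) (proj₁ bb′)
      (partner≢crossing-end ab aa′) (partners-distinct ab aa′ bb′)
      (partner≢crossing-end ba bb′ ∘ sym)
      (neighbour-of-partner ab aa′) (neighbour-of-matched-end ab aa′)
      (swap ∘ neighbour-of-matched-end ba bb′) (neighbour-of-partner ba bb′))
    where ba = crossing-sym ab
  ... | yes (_ , aa′) | no b-unmatched = shortPath 3 (matched-at-one-end ab aa′ b-unmatched)
  ... | no a-unmatched | yes (_ , bb′) =
    shortPath 3 (matched-at-one-end (crossing-sym ab) bb′ a-unmatched)
  ... | no a-unmatched | no b-unmatched = shortPath 2
    (path₂ simple connected (proj₁ ab) (neighbour-of-unmatched-end ab a-unmatched)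
      (neighbour-of-unmatched-end (crossing-sym ab) b-unmatched))

  matching⇒short-path : (∀ {u v} → Edge H u v → κ u ≡ κ v) → ShortPath H
  matching⇒short-path inner with any? (λ v → H root v ≟ᵇ true)
    where root = fromℕ< (proj₁ connected)
  ... | yes (_ , xy) = shortPath 2
    (path₂ simple connected xy (λ xv → partner-unique (xv , inner xv) (xy , inner xy))
      (λ yv → partner-unique (yv , inner yv) (yx , inner yx)))
    where yx = edge-sym simple xy
  ... | no isolated = shortPath 1 (path₁ simple connected λ xv → isolated (_ , xv))

  short-path : ShortPath H
  short-path with crossing?
  ... | yes (_ , _ , ab) = crossing⇒short-path ab
  ... | no no-crossing = matching⇒short-path λ {u} {v} uv →
    decidable-stable (κ u ≟ κ v) λ κu≢κv → no-crossing (u , v , uv , κu≢κv)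

fin2-pigeonhole : ∀ {a b c : Fin 2} → a ≢ b → a ≢ c → b ≡ c
fin2-pigeonhole {zero}     {zero}     {_}        a≢b _   = contradiction refl a≢b
fin2-pigeonhole {zero}     {suc zero} {zero}     _   a≢c = contradiction refl a≢c
fin2-pigeonhole {zero}     {suc zero} {suc zero} _   _   = refl
fin2-pigeonhole {suc zero} {zero}     {zero}     _   _   = refl
fin2-pigeonhole {suc zero} {zero}     {suc zero} _   a≢c = contradiction refl a≢c
fin2-pigeonhole {suc zero} {suc zero} {_}        a≢b _   = contradiction refl a≢b

module PairColouring (t : ℕ) where

  block : Fin (t * 2) → Fin t
  block = quotient 2

  side : Fin (t * 2) → Fin 2
  side = remainder {t} 2

  block-side-injective : ∀ {x y} → block x ≡ block y → side x ≡ side y → x ≡ y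
  block-side-injective {x} {y} bxy sxy = begin
    x                          ≡⟨ combine-remQuot {t} 2 x ⟨
    combine (block x) (side x) ≡⟨ cong₂ combine bxy sxy ⟩
    combine (block y) (side y) ≡⟨ combine-remQuot {t} 2 y ⟩
    y                          ∎
    where open ≡-Reasoning

  block-fibre : ∀ {x y z} → block x ≡ block y → block x ≡ block z → x ≢ y → x ≢ z → y ≡ z
  block-fibre bxy bxz x≢y x≢z = block-side-injective (trans (sym bxy) bxz)
    (fin2-pigeonhole (x≢y ∘ block-side-injective bxy) (x≢z ∘ block-side-injective bxz))

  block-combine : ∀ i j → block (combine i j) ≡ i
  block-combine i j = cong proj₁ (remQuot-combine i j)

  colour : Fin (t * 2) → Fin (t * 2) → ℕ
  colour x y with block x ≟ᶠ block y
  ... | yes _ = suc (toℕ (block x))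
  ... | no  _ = zero

  colour-within : ∀ {x y} → block x ≡ block y → colour x y ≡ suc (toℕ (block x))
  colour-within {x} {y} bxy with block x ≟ᶠ block y
  ... | yes _     = refl
  ... | no  bx≢by = contradiction bxy bx≢by

  colour-across : ∀ {x y} → block x ≢ block y → colour x y ≡ zero
  colour-across {x} {y} bx≢by with block x ≟ᶠ block y
  ... | yes bxy = contradiction bxy bx≢by
  ... | no  _   = refl

  colour-sym : ∀ x y → colour x y ≡ colour y x
  colour-sym x y with block x ≟ᶠ block y
  ... | yes bxy   = trans (cong (suc ∘ toℕ) bxy) (sym (colour-within (sym bxy)))
  ... | no  bx≢by = sym (colour-across (bx≢by ∘ sym))

  pairColouring : EdgeColoring (t * 2)
  pairColouring = colour , colour-sym

  colour-combine : ∀ i j k → colour (combine i j) (combine i k) ≡ suc (toℕ i)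
  colour-combine i j k = begin
    colour (combine i j) (combine i k) ≡⟨ colour-within (trans (block-combine i j) (sym (block-combine i k))) ⟩
    suc (toℕ (block (combine i j)))    ≡⟨ cong (suc ∘ toℕ) (block-combine i j) ⟩
    suc (toℕ i)                        ∎
    where open ≡-Reasoning

  pairColouring-colours : ColoredInAtLeast t pairColouring
  pairColouring-colours = (λ i → combine i zero) , (λ i → combine i (suc zero)) ,
    (λ i → (λ ()) ∘ combine-injectiveʳ i zero i (suc zero)) ,
    λ i j same-colour → toℕ-injective (suc-injective (begin
      suc (toℕ i)                                    ≡⟨ colour-combine i zero (suc zero) ⟨
      colour (combine i zero) (combine i (suc zero)) ≡⟨ same-colour ⟩
      colour (combine j zero) (combine j (suc zero)) ≡⟨ colour-combine j zero (suc zero) ⟩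
      suc (toℕ j)                                    ∎))
    where open ≡-Reasoning

  rainbow⇒short-path : ∀ {n} {H : Adjacency n} → IsSimple H → Connected H →
    RainbowCopy H pairColouring → ShortPath H
  rainbow⇒short-path {H = H} simple connected (φ , φ-injective , rainbow) =
    MatchingPlusEdge.short-path simple connected _≟ᶠ_ (block ∘ φ) inner-unique crossing-unique
    where
    φ-edge-≢ : ∀ {u v} → Edge H u v → φ u ≢ φ v
    φ-edge-≢ uv = edge⇒≢ simple uv ∘ φ-injective

    inner-unique : ∀ {u v w} → Edge H u v → Edge H u w →
      block (φ u) ≡ block (φ v) → block (φ u) ≡ block (φ w) → v ≡ w
    inner-unique uv uw buv buw = φ-injective (block-fibre buv buw (φ-edge-≢ uv) (φ-edge-≢ uw))

    crossing-unique : ∀ {u v u′ v′} → Edge H u v → Edge H u′ v′ →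
      block (φ u) ≢ block (φ v) → block (φ u′) ≢ block (φ v′) →
      (u ≡ u′ × v ≡ v′) ⊎ (u ≡ v′ × v ≡ u′)
    crossing-unique uv u′v′ buv bu′v′ =
      rainbow _ _ _ _ uv u′v′ (trans (colour-across buv) (sym (colour-across bu′v′)))

lemma1 : (n : ℕ) (H : Adjacency n) → InCalH H → (t : ℕ) → 1 ≤ t →
    Σ ℕ λ m → Σ (EdgeColoring m) λ c → ColoredInAtLeast t c × RainbowFree H c
lemma1 n H (simple , connected , not-short-path) t _ =
  t * 2 , pairColouring , pairColouring-colours , rainbow-free
  where
  open PairColouring t
  rainbow-free : RainbowFree H pairColouring
  rainbow-free copy with p , 1≤p , p≤4 , iso ← rainbow⇒short-path simple connected copy =
    not-short-path p 1≤p p≤4 iso
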